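{- Let $a,k,n\in\mathbb{N}$ with $k\le 2a$. Then $f_a(n,k)\le kn$.
   Context: For a graph $G$ with vertex ordering $v_1,\dots,v_n$, $d^+(v)$ is the set of neighbours of $v$ appearing later in the ordering. A list assignment $L$ gives each vertex a set $L(v)$ of colours; an $L$-colouring is a proper colouring $\alpha$ with $\alpha(v)\in L(v)$ for all $v$. $L$ is $a$-feasible if $|L(v)|\ge|d^+(v)|+a+1$ for all $v$. The total number of colours of $L$ is $|\bigcup_v L(v)|$. $\mathcal{G}(G,L)$ is the graph on $L$-colourings where two are adjacent iff they differ on exactly one vertex (diameter $+\infty$ if disconnected). $f_a(n,k)$ denotes the maximum diameter of $\mathcal{G}(G,L)$ over all graphs $G$ on $n$ vertices (with a vertex ordering) and all $a$-feasible list assignments $L$ with total number of colours $k$. -}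

module Defs where

open import Data.Nat using (ℕ; zero; suc; _+_; _*_; _≤_)
open import Data.Bool using (Bool; true; false; _∧_)
open import Data.Fin using (Fin; _<?_)
open import Data.Fin.Subset using (Subset; _∈_; ∣_∣)
open import Data.Vec using (tabulate)
open import Data.Product using (Σ; ∃; _×_; _,_)
open import Relation.Nullary using (¬_)
open import Relation.Nullary.Decidable using (⌊_⌋)
open import Relation.Binary.PropositionalEquality using (_≡_; _≢_)

-- A finite simple graph on vertex set Fin n; the vertex ordering
-- v_1,…,v_n is the natural order of Fin n.
record Graph (n : ℕ) : Set where
  field
    adj    : Fin n → Fin n → Bool
    sym    : ∀ u v → adj u v ≡ adj v u
    irrefl : ∀ v → adj v v ≡ false
open Graph public

dplus : ∀ {n} → Graph n → Fin n → Subset n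
dplus G v = tabulate (λ u → ⌊ v <? u ⌋ ∧ adj G v u)

ListAssignment : ℕ → ℕ → Set
ListAssignment n k = Fin n → Subset k

Feasible : ∀ {n k} → ℕ → Graph n → ListAssignment n k → Set
Feasible a G L = ∀ v → ∣ dplus G v ∣ + a + 1 ≤ ∣ L v ∣

-- The total number of colours of L is exactly k:
-- the union of the lists is all of Fin k.
TotalColours : ∀ {n k} → ListAssignment n k → Set
TotalColours {n} {k} L = ∀ (c : Fin k) → ∃ λ (v : Fin n) → c ∈ L v

Colouring : ℕ → ℕ → Set
Colouring n k = Fin n → Fin k

IsLColouring : ∀ {n k} → Graph n → ListAssignment n k → Colouring n k → Set
IsLColouring G L α =
  (∀ v → α v ∈ L v) × (∀ u v → adj G u v ≡ true → α u ≢ α v)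

DifferOnOne : ∀ {n k} → Colouring n k → Colouring n k → Set
DifferOnOne {n} α β = Σ (Fin n) λ v → (α v ≢ β v) × (∀ u → u ≢ v → α u ≡ β u)

-- A walk of length m in 𝒢(G,L) from α to β (colourings compared pointwise);
-- every colouring on the walk is an L-colouring.
data Walk {n k} (G : Graph n) (L : ListAssignment n k)
     : Colouring n k → Colouring n k → ℕ → Set where
  here : ∀ {α β} → (∀ v → α v ≡ β v) → Walk G L α β zero
  step : ∀ {α β γ m} → DifferOnOne α β → IsLColouring G L β →
         Walk G L β γ m → Walk G L α γ (suc m)

DiamAtMost : ∀ {n k} → Graph n → ListAssignment n k → ℕ → Set
DiamAtMost {n} {k} G L d =
  ∀ (α β : Colouring n k) → IsLColouring G L α → IsLColouring G L β →
  ∃ λ m → (m ≤ d) × Walk G L α β m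

-- Delete the first vertex v, recolour the rest by induction so that every vertex
-- moves at most k times, and replay that sequence with v put back. v only has to
-- move when a later neighbour is about to take its colour; it then moves to a colour
-- of L(v) used by no neighbour and not among the next a colours its neighbours will
-- receive, which exists because |L(v)| > |d⁺(v)| + a. So v moves at most once per a
-- neighbour moves: D times with a·D ≤ N + a − 1, where N ≤ k·|d⁺(v)| counts the
-- neighbour moves. Since |d⁺(v)| + a + 1 ≤ k ≤ 2a this forces D < k, and one last
-- move to its target colour keeps v within k moves, for n·k moves in total.
module Submission where

open import Defs hiding (sym)
open import Data.Bool using (Bool; true; false; if_then_else_; _∧_)
open import Data.Empty using (⊥-elim)
open import Data.Fin using (Fin; zero; suc; _≟_; _<?_)
open import Data.Fin.Subset using (Subset; inside; outside; _∈_; ∣_∣)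
open import Data.Fin.Subset.Properties using (∣p∣≤n)
open import Data.List using (List; []; _∷_; length; map; filterᵇ; take; _++_)
open import Data.List.Membership.Propositional using () renaming (_∈_ to _∈ˡ_; _∉_ to _∉ˡ_)
open import Data.List.Membership.Propositional.Properties using (∈-++⁺ˡ; ∈-++⁺ʳ)
open import Data.List.Properties using (length-++; length-take)
import Data.List.Relation.Unary.Any as Any
open import Data.Nat using (ℕ; zero; suc; _+_; _*_; _≤_; _<_; z≤n; s≤s; s≤s⁻¹)
open import Data.Nat.Properties
  using (≤-refl; ≤-reflexive; ≤-trans; ≤-<-trans; <-≤-trans; <⇒≤; m≤n⇒m≤1+n;
         m≤m+n; m≤n+m; m⊓n≤m; +-comm; +-suc; +-identityʳ; *-suc; *-comm; *-zeroʳ;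
         module ≤-Reasoning; +-mono-≤; +-monoˡ-≤; +-monoʳ-≤; +-monoʳ-<; *-monoʳ-≤; +-cancelʳ-≤; *-cancelˡ-<)
open import Data.Product using (∃; _×_; _,_; proj₁; proj₂)
open import Data.Vec using (_∷_; tabulate; here; there)
open import Data.Vec.Properties using (tabulate-cong)
open import Data.Vec.Functional using (tail) renaming (_∷_ to _∷ᶠ_)
open import Function using (_∘_)
open import Relation.Nullary using (Dec; yes; no; contradiction)
open import Relation.Nullary.Decidable using (⌊_⌋)
open import Relation.Binary.PropositionalEquality
  using (_≡_; _≢_; _≗_; refl; sym; trans; cong; subst; subst₂)

predecessors : ∀ {k} → List (Fin (suc k)) → List (Fin k)
predecessors []           = []
predecessors (zero ∷ xs)  = predecessors xs
predecessors (suc x ∷ xs) = x ∷ predecessors xs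

length-predecessors : ∀ {k} (xs : List (Fin (suc k))) → length (predecessors xs) ≤ length xs
length-predecessors []           = z≤n
length-predecessors (zero ∷ xs)  = m≤n⇒m≤1+n (length-predecessors xs)
length-predecessors (suc x ∷ xs) = s≤s (length-predecessors xs)

zero∈⇒length-predecessors< : ∀ {k} (xs : List (Fin (suc k))) →
  zero ∈ˡ xs → length (predecessors xs) < length xs
zero∈⇒length-predecessors< (zero ∷ xs)  _              = s≤s (length-predecessors xs)
zero∈⇒length-predecessors< (suc x ∷ xs) (Any.there 0∈) = s≤s (zero∈⇒length-predecessors< xs 0∈)

suc∈⇒∈-predecessors : ∀ {k} {x : Fin k} (xs : List (Fin (suc k))) →
  suc x ∈ˡ xs → x ∈ˡ predecessors xs
suc∈⇒∈-predecessors (zero ∷ xs)  (Any.there x∈)  = suc∈⇒∈-predecessors xs x∈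
suc∈⇒∈-predecessors (suc y ∷ xs) (Any.here refl) = Any.here refl
suc∈⇒∈-predecessors (suc y ∷ xs) (Any.there x∈)  = Any.there (suc∈⇒∈-predecessors xs x∈)

length<∣S∣⇒∃∈S∉ : ∀ {k} (S : Subset k) (xs : List (Fin k)) →
  length xs < ∣ S ∣ → ∃ λ x → x ∈ S × x ∉ˡ xs
length<∣S∣⇒∃∈S∉ {suc k} (inside ∷ S) xs |xs|<|S| with Any.any? (zero ≟_) xs
... | no 0∉xs = zero , here , 0∉xs
... | yes 0∈xs
  with x , x∈S , x∉ ← length<∣S∣⇒∃∈S∉ S (predecessors xs)
         (<-≤-trans (zero∈⇒length-predecessors< xs 0∈xs) (s≤s⁻¹ |xs|<|S|))
  = suc x , there x∈S , x∉ ∘ suc∈⇒∈-predecessors xs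
length<∣S∣⇒∃∈S∉ {suc k} (outside ∷ S) xs |xs|<|S|
  with x , x∈S , x∉ ← length<∣S∣⇒∃∈S∉ S (predecessors xs)
         (≤-<-trans (length-predecessors xs) |xs|<|S|)
  = suc x , there x∈S , x∉ ∘ suc∈⇒∈-predecessors xs

*-∣tabulate∣-suc : ∀ {n} k (p : Fin (suc n) → Bool) →
  k * ∣ tabulate (p ∘ suc) ∣ + (if p zero then k else 0) ≡ k * ∣ tabulate p ∣
*-∣tabulate∣-suc k p with p zero
... | true  = trans (+-comm _ k) (sym (*-suc k _))
... | false = +-identityʳ _

∣tabulate-true∣ : ∀ n → ∣ tabulate {n = n} (λ _ → true) ∣ ≡ n
∣tabulate-true∣ zero    = refl
∣tabulate-true∣ (suc n) = cong suc (∣tabulate-true∣ n)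

coloursOn : ∀ {m} {A : Set} → (Fin m → Bool) → (Fin m → A) → List A
coloursOn {zero}  p δ = []
coloursOn {suc m} p δ =
  if p zero then δ zero ∷ coloursOn (p ∘ suc) (δ ∘ suc) else coloursOn (p ∘ suc) (δ ∘ suc)

length-coloursOn : ∀ {m} {A : Set} (p : Fin m → Bool) (δ : Fin m → A) →
  length (coloursOn p δ) ≡ ∣ tabulate p ∣
length-coloursOn {zero}  p δ = refl
length-coloursOn {suc m} p δ with p zero
... | true  = cong suc (length-coloursOn (p ∘ suc) (δ ∘ suc))
... | false = length-coloursOn (p ∘ suc) (δ ∘ suc)

∈-coloursOn : ∀ {m} {A : Set} (p : Fin m → Bool) (δ : Fin m → A) {w} →
  p w ≡ true → δ w ∈ˡ coloursOn p δ
∈-coloursOn {suc m} p δ {zero} pw with p zero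
∈-coloursOn {suc m} p δ {zero} refl | true = Any.here refl
∈-coloursOn {suc m} p δ {suc w} pw with p zero
... | true  = Any.there (∈-coloursOn (p ∘ suc) (δ ∘ suc) pw)
... | false = ∈-coloursOn (p ∘ suc) (δ ∘ suc) pw

Move : ℕ → ℕ → Set
Move n k = Fin n × Fin k

movesAt : ∀ {n k} → (Fin n → Bool) → List (Move n k) → ℕ
movesAt p []             = 0
movesAt p ((v , _) ∷ ms) = if p v then suc (movesAt p ms) else movesAt p ms

movesAt-∷-true : ∀ {n k} {p : Fin n → Bool} {v c} (ms : List (Move n k)) →
  p v ≡ true → movesAt p ((v , c) ∷ ms) ≡ suc (movesAt p ms)
movesAt-∷-true ms pv rewrite pv = refl

movesAt-∷-false : ∀ {n k} {p : Fin n → Bool} {v c} (ms : List (Move n k)) →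
  p v ≡ false → movesAt p ((v , c) ∷ ms) ≡ movesAt p ms
movesAt-∷-false ms pv rewrite pv = refl

movesAt-true : ∀ {n k} (ms : List (Move n k)) → movesAt (λ _ → true) ms ≡ length ms
movesAt-true []       = refl
movesAt-true (m ∷ ms) = cong suc (movesAt-true ms)

-- Quantifying over all vertex sets p, not single vertices, makes the bound
-- additive: p = λ _ → true bounds the total number of moves.
EachVertexAtMost : ∀ {n k} → ℕ → List (Move n k) → Set
EachVertexAtMost ℓ ms = ∀ p → movesAt p ms ≤ ℓ * ∣ tabulate p ∣

record Recolours {n k} (v : Fin n) (c : Fin k) (γ γ′ : Colouring n k) : Set where
  field
    changes : γ v ≢ c
    sets    : γ′ v ≡ c
    keeps   : ∀ u → u ≢ v → γ u ≡ γ′ u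

data Recolouring {n k} (G : Graph n) (L : ListAssignment n k) (γ : Colouring n k)
     : List (Move n k) → Colouring n k → Set where
  done : ∀ {δ} → γ ≗ δ → Recolouring G L γ [] δ
  step : ∀ {v c γ′ ms δ} → Recolours v c γ γ′ → IsLColouring G L γ′ →
         Recolouring G L γ′ ms δ → Recolouring G L γ ((v , c) ∷ ms) δ

Recolouring-respˡ : ∀ {n k} {G : Graph n} {L : ListAssignment n k} {γ γ′ δ ms} →
  γ′ ≗ γ → Recolouring G L γ ms δ → Recolouring G L γ′ ms δ
Recolouring-respˡ γ′≗γ (done γ≗δ) = done (λ u → trans (γ′≗γ u) (γ≗δ u))
Recolouring-respˡ γ′≗γ (step {v} rec ok rest) = step rec′ ok rest
  where
  open Recolours rec
  rec′ : Recolours v _ _ _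
  rec′ = record { changes = changes ∘ trans (sym (γ′≗γ v))
                ; sets    = sets
                ; keeps   = λ u u≢v → trans (γ′≗γ u) (keeps u u≢v) }

Recolouring⇒Walk : ∀ {n k} {G : Graph n} {L : ListAssignment n k} {γ δ ms} →
  Recolouring G L γ ms δ → Walk G L γ δ (length ms)
Recolouring⇒Walk (done γ≗δ)             = here γ≗δ
Recolouring⇒Walk (step {v} rec ok rest) =
  step (v , (λ eq → changes (trans eq sets)) , keeps) ok (Recolouring⇒Walk rest)
  where open Recolours rec

Recolours-suc : ∀ {n k} {w : Fin n} {z x : Fin k} {δ δ′ : Colouring n k} →
  Recolours w z δ δ′ → Recolours (suc w) z (x ∷ᶠ δ) (x ∷ᶠ δ′)
Recolours-suc rec = record { changes = changes ; sets = sets ; keeps = keeps′ }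
  where
  open Recolours rec
  keeps′ : ∀ u → u ≢ suc _ → _
  keeps′ zero    _     = refl
  keeps′ (suc u) u≢sw = keeps u (u≢sw ∘ cong suc)

Recolours-zero : ∀ {n k} {x : Fin k} {δ : Colouring n k} {γ : Colouring (suc n) k} →
  x ≢ γ zero → δ ≗ tail γ → Recolours zero (γ zero) (x ∷ᶠ δ) γ
Recolours-zero x≢ δ≗ = record { changes = x≢ ; sets = refl ; keeps = keeps }
  where
  keeps : ∀ u → u ≢ zero → _
  keeps zero    0≢0 = ⊥-elim (0≢0 refl)
  keeps (suc u) _   = δ≗ u

dropFirst : ∀ {n} → Graph (suc n) → Graph n
dropFirst G = record
  { adj    = λ u v → adj G (suc u) (suc v)
  ; sym    = λ u v → Graph.sym G (suc u) (suc v)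
  ; irrefl = irrefl G ∘ suc
  }

⌊suc<?suc⌋ : ∀ {n} (w u : Fin n) → ⌊ suc w <? suc u ⌋ ≡ ⌊ w <? u ⌋
⌊suc<?suc⌋ w u with w <? u | suc w <? suc u
... | yes _   | yes _   = refl
... | no  _   | no  _   = refl
... | yes w<u | no  w≮u = ⊥-elim (w≮u (s≤s w<u))
... | no  w≮u | yes w<u = ⊥-elim (w≮u (s≤s⁻¹ w<u))

Feasible-dropFirst : ∀ {a n k} {G : Graph (suc n)} {L : ListAssignment (suc n) k} →
  Feasible a G L → Feasible a (dropFirst G) (tail L)
Feasible-dropFirst {a} {G = G} {L} feasible w =
  subst (λ d → d + a + 1 ≤ ∣ L (suc w) ∣) ∣dplus∣-suc (feasible (suc w))
  where
  ∣dplus∣-suc : ∣ dplus G (suc w) ∣ ≡ ∣ dplus (dropFirst G) w ∣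
  ∣dplus∣-suc =
    cong ∣_∣ (tabulate-cong λ u → cong (_∧ adj G (suc w) (suc u)) (⌊suc<?suc⌋ w u))

IsLColouring-tail : ∀ {n k} {G : Graph (suc n)} {L : ListAssignment (suc n) k} {γ} →
  IsLColouring G L γ → IsLColouring (dropFirst G) (tail L) (tail γ)
IsLColouring-tail (inL , proper) = inL ∘ suc , λ u v → proper (suc u) (suc v)

module Extension {n k} (G : Graph (suc n)) (L : ListAssignment (suc n) k) (b : ℕ)
  (room : ∣ dplus G zero ∣ + suc b + 1 ≤ ∣ L zero ∣)
  (β : Colouring (suc n) k) (β-ok : IsLColouring G L β) where

  G⁻ : Graph n
  G⁻ = dropFirst G

  L⁻ : ListAssignment n k
  L⁻ = tail L

  neighbour : Fin n → Bool
  neighbour w = adj G zero (suc w)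

  Avoids : Colouring n k → Fin k → Set
  Avoids δ x = ∀ w → neighbour w ≡ true → δ w ≢ x

  upcoming : ℕ → List (Move n k) → List (Fin k)
  upcoming r ms = take r (map proj₂ (filterᵇ (neighbour ∘ proj₁) ms))

  length-upcoming : ∀ r ms → length (upcoming r ms) ≤ r
  length-upcoming r ms = ≤-trans (≤-reflexive (length-take r _)) (m⊓n≤m r _)

  Avoids-head : ∀ {γ} → IsLColouring G L γ → Avoids (tail γ) (γ zero)
  Avoids-head (_ , proper) w adj₀ = proper (suc w) zero (trans (Graph.sym G (suc w) zero) adj₀)

  Avoids-step : ∀ {δ δ′ w z x} → Recolours w z δ δ′ →
    (neighbour w ≡ true → z ≢ x) → Avoids δ x → Avoids δ′ x
  Avoids-step {w = w} rec z≢x avoids u isNb with u ≟ w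
  ... | yes refl = z≢x isNb ∘ trans (sym (Recolours.sets rec))
  ... | no  u≢w  = avoids u isNb ∘ trans (Recolours.keeps rec u u≢w)

  IsLColouring-∷ : ∀ {x δ} → x ∈ L zero → IsLColouring G⁻ L⁻ δ → Avoids δ x →
    IsLColouring G L (x ∷ᶠ δ)
  IsLColouring-∷ {x} {δ} x∈L (inL , proper) avoids = inL′ , proper′
    where
    inL′ : ∀ v → (x ∷ᶠ δ) v ∈ L v
    inL′ zero    = x∈L
    inL′ (suc w) = inL w
    proper′ : ∀ u v → adj G u v ≡ true → (x ∷ᶠ δ) u ≢ (x ∷ᶠ δ) v
    proper′ zero    zero    adj₀ with trans (sym adj₀) (irrefl G zero)
    ... | ()
    proper′ zero    (suc w) adj₀ = avoids w adj₀ ∘ sym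
    proper′ (suc w) zero    adj₀ = avoids w (trans (Graph.sym G zero (suc w)) adj₀)
    proper′ (suc u) (suc w) adj₀ = proper u w adj₀

  safeColour : ∀ δ (cs : List (Fin k)) → length cs ≤ suc b →
    ∃ λ x → x ∈ L zero × Avoids δ x × x ∉ˡ cs
  safeColour δ cs |cs|≤ = pick (length<∣S∣⇒∃∈S∉ (L zero) forbidden shorter)
    where
    forbidden : List (Fin k)
    forbidden = coloursOn neighbour δ ++ cs
    shorter : length forbidden < ∣ L zero ∣
    shorter = ≤-trans (s≤s (≤-trans (≤-reflexive (length-++ (coloursOn neighbour δ)))
                                    (+-mono-≤ (≤-reflexive (length-coloursOn neighbour δ)) |cs|≤)))
                      (≤-trans (≤-reflexive (+-comm 1 _)) room)
    pick : (∃ λ x → x ∈ L zero × x ∉ˡ forbidden) → ∃ λ x → x ∈ L zero × Avoids δ x × x ∉ˡ cs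
    pick (x , x∈L , x∉) =
      x , x∈L , avoids , x∉ ∘ ∈-++⁺ʳ _
      where
      avoids : Avoids δ x
      avoids w isNb δw≡x =
        x∉ (∈-++⁺ˡ (subst (_∈ˡ coloursOn neighbour δ) δw≡x (∈-coloursOn neighbour δ isNb)))

  -- Replaying ms with vertex 0 starting at colour x, which survives the next r
  -- neighbour moves; vertex 0 dodges `dodges` times and may make one final move.
  record Lifted (ms : List (Move n k)) (δ : Colouring n k) (x : Fin k) (r : ℕ) : Set where
    constructor lifted
    field
      moves       : List (Move (suc n) k)
      dodges      : ℕ
      recolouring : Recolouring G L (x ∷ᶠ δ) moves β
      counts      : ∀ p → movesAt p moves
                          ≤ movesAt (p ∘ suc) ms + (if p zero then suc dodges else 0)
      budget      : suc b * dodges + r ≤ movesAt neighbour ms + b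

  Lifted-≤ : ∀ {ms δ x r r′} → r′ ≤ r → Lifted ms δ x r → Lifted ms δ x r′
  Lifted-≤ r′≤r (lifted moves D rec counts budget) =
    lifted moves D rec counts (≤-trans (+-monoʳ-≤ (suc b * D) r′≤r) budget)

  arrive : ∀ {δ} x r → r ≤ b → δ ≗ tail β → Lifted [] δ x r
  arrive x r r≤b δ≗β = Lifted-≤ r≤b (finalMove (x ≟ β zero))
    where
    budget₀ : suc b * 0 + b ≤ 0 + b
    budget₀ = ≤-reflexive (cong (_+ b) (*-zeroʳ (suc b)))
    finalMove : Dec (x ≡ β zero) → Lifted [] _ x b
    finalMove (yes refl) = lifted [] 0 (done x∷δ≗β) (λ _ → z≤n) budget₀
      where
      x∷δ≗β : x ∷ᶠ _ ≗ β
      x∷δ≗β zero    = refl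
      x∷δ≗β (suc w) = δ≗β w
    finalMove (no x≢β₀) =
      lifted ((zero , β zero) ∷ []) 0 (step (Recolours-zero x≢β₀ δ≗β) β-ok (done λ _ → refl))
             (λ _ → ≤-refl) budget₀

  replay : ∀ {w z δ δ′ ms x r r′} → Recolours w z δ δ′ → x ∈ L zero →
    IsLColouring G⁻ L⁻ δ′ → Avoids δ′ x → (l : Lifted ms δ′ x r) →
    suc b * Lifted.dodges l + r′ ≤ movesAt neighbour ((w , z) ∷ ms) + b →
    Lifted ((w , z) ∷ ms) δ x r′
  replay {w} {z} {ms = ms} rec x∈L ok avoids (lifted moves D rc counts _) budget =
    lifted ((suc w , z) ∷ moves) D (step (Recolours-suc rec) (IsLColouring-∷ x∈L ok avoids) rc)
           counts′ budget
    where
    counts′ : ∀ p → movesAt p ((suc w , z) ∷ moves)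
                    ≤ movesAt (p ∘ suc) ((w , z) ∷ ms) + (if p zero then suc D else 0)
    counts′ p with p (suc w)
    ... | true  = s≤s (counts p)
    ... | false = counts p

  dodge : ∀ {δ ms x x′} → x ≢ x′ → x′ ∈ L zero → IsLColouring G⁻ L⁻ δ → Avoids δ x′ →
    Lifted ms δ x′ (suc b) → Lifted ms δ x 0
  dodge {ms = ms} {x′ = x′} x≢x′ x′∈L ok avoids (lifted moves D rc counts budget) =
    lifted ((zero , x′) ∷ moves) (suc D)
           (step (Recolours-zero x≢x′ (λ _ → refl)) (IsLColouring-∷ x′∈L ok avoids) rc)
           counts′ (≤-trans (≤-reflexive dodge-cost) budget)
    where
    dodge-cost : suc b * suc D + 0 ≡ suc b * D + suc b
    dodge-cost = trans (+-identityʳ _) (trans (*-suc (suc b) D) (+-comm (suc b) _))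
    counts′ : ∀ p → movesAt p ((zero , x′) ∷ moves)
                    ≤ movesAt (p ∘ suc) ms + (if p zero then suc (suc D) else 0)
    counts′ p with p zero | counts p
    ... | true  | c = ≤-trans (s≤s c) (≤-reflexive (sym (+-suc _ (suc D))))
    ... | false | c = c

  lift : ∀ {ms δ} x r → r ≤ b → x ∈ L zero → IsLColouring G⁻ L⁻ δ → Avoids δ x →
    x ∉ˡ upcoming r ms → Recolouring G⁻ L⁻ δ ms (tail β) → Lifted ms δ x r

  survive : ∀ {w z ms δ} x r → r ≤ b → x ∈ L zero → Avoids δ x → x ∉ˡ z ∷ upcoming r ms →
    neighbour w ≡ true → Recolouring G⁻ L⁻ δ ((w , z) ∷ ms) (tail β) →
    Lifted ((w , z) ∷ ms) δ x (suc r)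

  lift x r r≤b _ _ _ _ (done δ≗β) = arrive x r r≤b δ≗β
  lift x r r≤b x∈L _ avoids fresh (step {w} {z} {ms = ms} rec ok rest) with neighbour w in isNb
  ... | false = replay rec x∈L ok avoids′ l budget
    where
    avoids′ : Avoids _ x
    avoids′ = Avoids-step rec (λ isNb′ → contradiction (trans (sym isNb) isNb′) λ ()) avoids
    l : Lifted ms _ x r
    l = lift x r r≤b x∈L ok avoids′ fresh rest
    budget : suc b * Lifted.dodges l + r ≤ movesAt neighbour ((w , z) ∷ ms) + b
    budget = ≤-trans (Lifted.budget l)
                     (≤-reflexive (cong (_+ b) (sym (movesAt-∷-false {c = z} ms isNb))))
  lift x (suc r) r<b x∈L _ avoids fresh s@(step _ _ _) | true =
    survive x r (<⇒≤ r<b) x∈L avoids fresh isNb s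
  -- The colour of vertex 0 is not known to survive this neighbour move: re-choose it.
  lift x zero _ x∈L ok avoids _ s@(step {c = z} {ms = ms} _ _ _) | true
    with x′ , x′∈L , avoids′ , fresh′ ←
           safeColour _ (z ∷ upcoming b ms) (s≤s (length-upcoming b ms))
    with x ≟ x′
  ... | yes refl = Lifted-≤ z≤n (survive x b ≤-refl x∈L avoids′ fresh′ isNb s)
  ... | no  x≢x′ = dodge x≢x′ x′∈L ok avoids′ (survive x′ b ≤-refl x′∈L avoids′ fresh′ isNb s)

  survive {w} {z} {ms} x r r≤b x∈L avoids fresh isNb (step rec ok rest) =
    replay rec x∈L ok avoids′ l budget
    where
    avoids′ : Avoids _ x
    avoids′ = Avoids-step rec (λ _ z≡x → fresh (Any.here (sym z≡x))) avoids
    l : Lifted ms _ x r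
    l = lift x r r≤b x∈L ok avoids′ (fresh ∘ Any.there) rest
    budget : suc b * Lifted.dodges l + suc r ≤ movesAt neighbour ((w , z) ∷ ms) + b
    budget = ≤-trans (≤-reflexive (+-suc _ r))
               (≤-trans (s≤s (Lifted.budget l))
                        (≤-reflexive (cong (_+ b) (sym (movesAt-∷-true {c = z} ms isNb)))))

  extend : ∀ {α ms} → IsLColouring G L α → Recolouring G⁻ L⁻ (tail α) ms (tail β) →
    Lifted ms (tail α) (α zero) 0
  extend {α} α-ok@(inL , _) rec =
    lift (α zero) 0 z≤n (inL zero) (IsLColouring-tail {G = G} α-ok) (Avoids-head α-ok) (λ ()) rec

dodges<k : ∀ {b k d N D} → d + suc b + 1 ≤ k → k ≤ 2 * suc b → N ≤ k * d →
  suc b * D + 0 ≤ N + b → D < k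
dodges<k {b} {k} {d} {N} {D} room k≤2a N≤kd budget = *-cancelˡ-< (suc b) D k (begin-strict
  suc b * D      ≡⟨ +-identityʳ _ ⟨
  suc b * D + 0  ≤⟨ budget ⟩
  N + b          ≤⟨ +-monoˡ-≤ b (≤-trans N≤kd (*-monoʳ-≤ k d≤b)) ⟩
  k * b + b      <⟨ +-monoʳ-< (k * b) b<k ⟩
  k * b + k      ≡⟨ +-comm (k * b) k ⟩
  k + k * b      ≡⟨ *-suc k b ⟨
  k * suc b      ≡⟨ *-comm k (suc b) ⟩
  suc b * k      ∎)
  where
  open ≤-Reasoning
  b<k : b < k
  b<k = ≤-trans (≤-trans (m≤n+m (suc b) d) (m≤m+n _ 1)) room
  d≤b : d ≤ b
  d≤b = s≤s⁻¹ (+-cancelʳ-≤ (suc b) (suc d) (suc b) (begin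
    suc d + suc b     ≡⟨ +-comm 1 (d + suc b) ⟩
    d + suc b + 1     ≤⟨ ≤-trans room k≤2a ⟩
    2 * suc b         ≡⟨ cong (suc b +_) (+-identityʳ (suc b)) ⟩
    suc b + suc b     ∎))

extend-recolouring : ∀ {b k n} → k ≤ 2 * suc b →
  (G : Graph (suc n)) (L : ListAssignment (suc n) k) → Feasible (suc b) G L →
  ∀ {α β ms} → IsLColouring G L α → IsLColouring G L β →
  Recolouring (dropFirst G) (tail L) (tail α) ms (tail β) → EachVertexAtMost k ms →
  ∃ λ moves → Recolouring G L α moves β × EachVertexAtMost k moves
extend-recolouring {b} {k} k≤2a G L feasible {α} {β} {ms} α-ok β-ok rec few =
  moves , Recolouring-respˡ α≗ recolouring , λ p → ≤-trans (counts p) (bound p)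
  where
  open Extension G L b (feasible zero) β β-ok
  open Lifted (extend α-ok rec)
  α≗ : α ≗ α zero ∷ᶠ tail α
  α≗ zero    = refl
  α≗ (suc w) = refl
  finalMoves≤k : ∀ c → (if c then suc dodges else 0) ≤ (if c then k else 0)
  finalMoves≤k true  =
    dodges<k (≤-trans (feasible zero) (∣p∣≤n (L zero))) k≤2a (few neighbour) budget
  finalMoves≤k false = z≤n
  bound : ∀ p → movesAt (p ∘ suc) ms + (if p zero then suc dodges else 0) ≤ k * ∣ tabulate p ∣
  bound p = ≤-trans (+-mono-≤ (few (p ∘ suc)) (finalMoves≤k (p zero)))
                    (≤-reflexive (*-∣tabulate∣-suc k p))

recolouring : ∀ {a k} → k ≤ 2 * a → ∀ {n} (G : Graph n) (L : ListAssignment n k) →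
  Feasible a G L → ∀ {α β} → IsLColouring G L α → IsLColouring G L β →
  ∃ λ ms → Recolouring G L α ms β × EachVertexAtMost k ms
recolouring k≤2a {zero} G L feasible α-ok β-ok = [] , done (λ ()) , λ _ → z≤n
recolouring {zero} k≤0 {suc n} G L feasible α-ok β-ok =
  contradiction (≤-trans (m≤n+m 1 _) (≤-trans (feasible zero) (≤-trans (∣p∣≤n (L zero)) k≤0)))
                λ ()
recolouring {suc b} k≤2a {suc n} G L feasible α-ok β-ok
  with ms , rec , few ←
         recolouring k≤2a (dropFirst G) (tail L) (Feasible-dropFirst {G = G} {L} feasible)
                     (IsLColouring-tail {G = G} α-ok) (IsLColouring-tail {G = G} β-ok)
  = extend-recolouring k≤2a G L feasible α-ok β-ok rec few

lemma1 : (a k n : ℕ) → k ≤ 2 * a →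
    (G : Graph n) (L : ListAssignment n k) →
    Feasible a G L → TotalColours L →
    DiamAtMost G L (k * n)
lemma1 a k n k≤2a G L feasible _ α β α-ok β-ok
  with ms , rec , few ← recolouring k≤2a G L feasible α-ok β-ok
  = length ms , length≤kn , Recolouring⇒Walk rec
  where
  length≤kn : length ms ≤ k * n
  length≤kn = subst₂ _≤_ (movesAt-true ms) (cong (k *_) (∣tabulate-true∣ n)) (few (λ _ → true))
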